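{- Let $T$ be a tree and $\underline C$ a transitive ladder system on $T$. If $T$ has no branching at limit levels and contains no uncountable chains, then $X_{\underline C}$ contains no uncountable $\omega$-connected subsets; that is, for every uncountable $A\subseteq T$ there are $s,t\in A$ and a finite $F\subseteq A$ such that every path in $X_{\underline C}$ from $s$ to $t$ with all vertices in $A$ passes through $F$.
   Context: A tree is a partial order $(T,\leq)$ in which $t^\downarrow=\{s\in T:s<t\}$ is well ordered for every $t$; $ht(t)$ is the order type of $t^\downarrow$. $T$ has no branching at limit levels if $t^\downarrow=s^\downarrow$ implies $t=s$ for all $s,t$ of limit height. A ladder system on $T$ is a family $\underline C=\{C_t:t\in T\}$ with $C_t\subseteq t^\downarrow$ either finite or a cofinal subset of $t^\downarrow$ of order type $\omega$. $X_{\underline C}$ is the graph with vertex set $T$ and edges $\{s,t\}$ for $t\in T$, $s\in C_t$. $\underline C$ is transitive if $C_t\cap s^\downarrow\subseteq C_s$ for all $t\in T$ and $s\in C_t$. -}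

module Defs where

open import Level using (0ℓ)
open import Data.Nat using (ℕ; suc)
open import Data.Product using (Σ; ∃; _×_; _,_)
open import Data.Sum using (_⊎_)
open import Data.List using (List)
open import Data.List.Membership.Propositional using (_∈_)
open import Relation.Nullary using (¬_)
open import Relation.Binary.PropositionalEquality using (_≡_)
open import Relation.Binary.Structures using (IsStrictPartialOrder)
open import Induction.WellFounded using (WellFounded)

record Tree : Set₁ where
  field
    Carrier : Set
    _<_     : Carrier → Carrier → Set
    isSPO   : IsStrictPartialOrder _≡_ _<_
    below-linear : ∀ t s s' → s < t → s' < t → (s < s') ⊎ (s ≡ s') ⊎ (s' < s)
    below-wf : ∀ t → WellFounded {A = Σ Carrier (λ s → s < t)}
                       (λ x y → Data.Product.proj₁ x < Data.Product.proj₁ y)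

module _ (T : Tree) where
  open Tree T

  Subset : Set₁
  Subset = Carrier → Set

  Countable : Subset → Set
  Countable A = Σ (Carrier → ℕ) λ f → ∀ x y → A x → A y → f x ≡ f y → x ≡ y

  Uncountable : Subset → Set
  Uncountable A = ¬ Countable A

  IsChain : Subset → Set
  IsChain A = ∀ x y → A x → A y → (x < y) ⊎ (x ≡ y) ⊎ (y < x)

  NoUncountableChains : Set₁
  NoUncountableChains = ∀ (A : Subset) → IsChain A → Countable A

  LimitHeight : Carrier → Set
  LimitHeight t = (∃ λ s → s < t) × (∀ s → s < t → ∃ λ s' → (s < s') × (s' < t))

  NoLimitBranching : Set
  NoLimitBranching = ∀ s t → LimitHeight s → LimitHeight t →
                     (∀ u → (u < s → u < t) × (u < t → u < s)) → s ≡ t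

  -- C t s  means  s ∈ C_t
  Ladder : Set₁
  Ladder = Carrier → Carrier → Set

  FiniteSet : Subset → Set
  FiniteSet B = Σ (List Carrier) λ xs → ∀ s → (B s → s ∈ xs) × (s ∈ xs → B s)

  -- C_t is a cofinal subset of t↓ of order type ω: the range of a strictly
  -- increasing ω-sequence, cofinal in t↓
  CofinalOmega : Carrier → Subset → Set
  CofinalOmega t B = Σ (ℕ → Carrier) λ f →
      (∀ n → f n < f (suc n))
    × (∀ s → (B s → ∃ λ n → f n ≡ s) × ((∃ λ n → f n ≡ s) → B s))
    × (∀ s → s < t → ∃ λ n → (s ≡ f n) ⊎ (s < f n))

  IsLadderSystem : Ladder → Set
  IsLadderSystem C = ∀ t → (∀ s → C t s → s < t) × (FiniteSet (C t) ⊎ CofinalOmega t (C t))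

  IsTransitive : Ladder → Set
  IsTransitive C = ∀ t s → C t s → ∀ u → C t u → u < s → C s u

  Adj : Ladder → Carrier → Carrier → Set
  Adj C s t = C t s ⊎ C s t

  data PathIn (C : Ladder) (A : Subset) : Carrier → Carrier → Set where
    stop : ∀ {x} → A x → PathIn C A x x
    step : ∀ {x y z} → A x → Adj C x y → PathIn C A y z → PathIn C A x z

  Meets : ∀ {C A x y} → List Carrier → PathIn C A x y → Set
  Meets F (stop {x} _) = x ∈ F
  Meets F (step {x} _ _ p) = (x ∈ F) ⊎ Meets F p

  NotOmegaConnected : Ladder → Subset → Set
  NotOmegaConnected C A =
    ∃ λ s → ∃ λ t → ∃ λ (F : List Carrier) →
      A s × A t × (∀ u → u ∈ F → A u) × ¬ (s ∈ F) × ¬ (t ∈ F)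
      × (∀ (p : PathIn C A s t) → Meets F p)

-- Since A is uncountable it is not a chain, so it contains incomparable s and t;
-- take s minimal in A among the elements incomparable with t. Then every element
-- of A ∩ C_s lies below t. Say x descends to s when a chain of ladder edges
-- x ∋ … ∋ s leads down from x to s; such x are ≥ s, hence never t.
-- By transitivity of the ladder system, a down edge from such a vertex either
-- lands in C_s or in another vertex descending to s, and an up edge trivially
-- preserves the property. So every A-path from s to t passes through A ∩ C_s,
-- which is finite: either C_s is finite, or ht(s) is a limit and, as there is no
-- branching at limit levels, s↓ ⊈ t↓, so only an initial segment of the
-- ω-sequence C_s lies below t.
module Submission where

open import Defs
open import Level using (0ℓ)
open import Axiom.ExcludedMiddle using (ExcludedMiddle)
open import Axiom.DoubleNegationElimination using (em⇒dne)
open import Data.Nat as ℕ using (ℕ; suc; s≤s)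
open import Data.Nat.Properties using (≰⇒>; m≤n⇒m<n∨m≡n)
open import Data.Product using (∃; ∃₂; _×_; _,_; proj₁; proj₂)
open import Data.Sum using (_⊎_; inj₁; inj₂)
open import Data.Empty using (⊥-elim)
open import Data.List using (List; filter; applyUpTo)
open import Data.List.Membership.Propositional using (_∈_)
open import Data.List.Membership.Propositional.Properties
  using (∈-filter⁺; ∈-filter⁻; ∈-applyUpTo⁺)
open import Relation.Nullary using (¬_; yes; no)
open import Relation.Binary.PropositionalEquality using (_≡_; refl; sym; subst)
open import Relation.Binary.Structures using (IsStrictPartialOrder)
open import Induction.WellFounded using (WellFounded; Acc; acc)

module TreeProperties (em : ExcludedMiddle 0ℓ) (T : Tree) where
  open Tree T
  open IsStrictPartialOrder isSPO using (irrefl; trans)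

  dne : {P : Set} → ¬ ¬ P → P
  dne = em⇒dne em

  _≤_ : Carrier → Carrier → Set
  x ≤ y = x ≡ y ⊎ x < y

  Comparable : Carrier → Carrier → Set
  Comparable x y = x < y ⊎ x ≡ y ⊎ y < x

  <-irrefl : ∀ {x} → ¬ x < x
  <-irrefl = irrefl refl

  ≤-<-trans : ∀ {x y z} → x ≤ y → y < z → x < z
  ≤-<-trans (inj₁ refl) y<z = y<z
  ≤-<-trans (inj₂ x<y) y<z = trans x<y y<z

  ≤⇒comparable : ∀ {x y} → x ≤ y → Comparable x y
  ≤⇒comparable (inj₁ x≡y) = inj₂ (inj₁ x≡y)
  ≤⇒comparable (inj₂ x<y) = inj₁ x<y

  comparable-below : ∀ {t x m} → x < t → m ≤ t → Comparable x m
  comparable-below x<t (inj₁ refl) = inj₁ x<t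
  comparable-below {t} x<t (inj₂ m<t) = below-linear t _ _ x<t m<t

  incomparable-below : ∀ {s t y} → y < s → ¬ Comparable s t → ¬ y < t → ¬ Comparable y t
  incomparable-below y<s s⊥t ¬y<t (inj₁ y<t) = ¬y<t y<t
  incomparable-below y<s s⊥t ¬y<t (inj₂ (inj₁ refl)) = s⊥t (inj₂ (inj₂ y<s))
  incomparable-below y<s s⊥t ¬y<t (inj₂ (inj₂ t<y)) = s⊥t (inj₂ (inj₂ (trans t<y y<s)))

  <-wellFounded : WellFounded _<_
  <-wellFounded t = acc λ s<t → accessible (below-wf t (_ , s<t))
    where
      accessible : ∀ {s} {s<t : s < t} → Acc (λ x y → proj₁ x < proj₁ y) (s , s<t) → Acc _<_ s
      accessible {s<t = s<t} (acc rs) =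
        acc λ r<s → accessible (rs {_ , trans r<s s<t} r<s)

  ∃-minimal : (P : Carrier → Set) → ∀ {x} → P x →
              ∃ λ m → P m × m ≤ x × (∀ {z} → z < m → ¬ P z)
  ∃-minimal P = go (<-wellFounded _)
    where
      go : ∀ {x} → Acc _<_ x → P x → ∃ λ m → P m × m ≤ x × (∀ {z} → z < m → ¬ P z)
      go {x} (acc rs) px with em {∃ λ z → z < x × P z}
      ... | no ∄ = x , px , inj₁ refl , λ z<x pz → ∄ (_ , z<x , pz)
      ... | yes (z , z<x , pz) with go (rs z<x) pz
      ...   | m , pm , m≤z , min = m , pm , inj₂ (≤-<-trans m≤z z<x) , min

  increasing⇒monotone : (f : ℕ → Carrier) → (∀ n → f n < f (suc n)) →
                        ∀ {m n} → m ℕ.< n → f m < f n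
  increasing⇒monotone f inc {m} {suc n} (s≤s m≤n) with m≤n⇒m<n∨m≡n m≤n
  ... | inj₁ m<n = trans (increasing⇒monotone f inc m<n) (inc n)
  ... | inj₂ refl = inc m

  covered⇒finite : ∀ {B : Subset T} xs → (∀ {y} → B y → y ∈ xs) → FiniteSet T B
  covered⇒finite xs cover =
    filter B? xs , λ y → (λ By → ∈-filter⁺ B? (cover By) By) ,
                         (λ y∈ → proj₂ (∈-filter⁻ B? {xs = xs} y∈))
    where B? = λ _ → em

  limitHeight-≡ : NoLimitBranching T → ∀ {s t} → LimitHeight T s →
                  (∀ u → (u < s → u < t) × (u < t → u < s)) → s ≡ t
  limitHeight-≡ nlb {s} {t} lim@((u , u<s) , unbounded) s↓≡t↓ = nlb s t lim limₜ s↓≡t↓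
    where
      limₜ : LimitHeight T t
      limₜ = (u , proj₁ (s↓≡t↓ u) u<s) , λ v v<t →
        let (w , v<w , w<s) = unbounded v (proj₂ (s↓≡t↓ v) v<t)
        in w , v<w , proj₁ (s↓≡t↓ w) w<s

  -- m is the least element of the branch of t not below s; then m↓ = s↓.
  ↓⊆⇒≤ : NoLimitBranching T → ∀ {s t} → LimitHeight T s → (∀ {u} → u < s → u < t) → s ≤ t
  ↓⊆⇒≤ nlb {s} {t} lim s↓⊆t↓
    with ∃-minimal (λ u → ¬ u < s) {t} (λ t<s → <-irrefl (s↓⊆t↓ t<s))
  ... | m , ¬m<s , m≤t , min = subst (_≤ t) (sym s≡m) m≤t
    where
      below-m : ∀ {u} → u < s → u < m
      below-m u<s with comparable-below (s↓⊆t↓ u<s) m≤t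
      ... | inj₁ u<m = u<m
      ... | inj₂ (inj₁ refl) = ⊥-elim (¬m<s u<s)
      ... | inj₂ (inj₂ m<u) = ⊥-elim (¬m<s (trans m<u u<s))

      s≡m : s ≡ m
      s≡m = limitHeight-≡ nlb lim λ u → below-m , λ u<m → dne (min u<m)

  incomparable⇒escapes : NoLimitBranching T → ∀ {s t} → LimitHeight T s →
                         ¬ Comparable s t → ∃ λ e → e < s × ¬ e < t
  incomparable⇒escapes nlb lim s⊥t = dne λ ∄ →
    s⊥t (≤⇒comparable (↓⊆⇒≤ nlb lim λ e<s → dne λ ¬e<t → ∄ (_ , e<s , ¬e<t)))

  cofinal⇒limitHeight : ∀ {t B} → (∀ {s} → B s → s < t) → CofinalOmega T t B → LimitHeight T t
  cofinal⇒limitHeight {t} B⊆t↓ (f , inc , range , cofinal) =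
    (f 0 , f<t 0) , λ u u<t → let (n , u≤fn) = cofinal u u<t in
      f (suc n) , ≤-<-trans u≤fn (inc n) , f<t (suc n)
    where
      f<t : ∀ n → f n < t
      f<t n = B⊆t↓ (proj₂ (range (f n)) (n , refl))

  cofinal-bounded-covered : ∀ {s t e B} → CofinalOmega T s B → e < s → ¬ e < t →
                            ∃ λ xs → ∀ {y} → B y → y < t → y ∈ xs
  cofinal-bounded-covered {t = t} {e} {B} (f , inc , range , cofinal) e<s ¬e<t
    with cofinal e e<s
  ... | n , e≤fn = applyUpTo f (suc n) , covered
    where
      covered : ∀ {y} → B y → y < t → y ∈ applyUpTo f (suc n)
      covered {y} By y<t with proj₁ (range y) By
      ... | k , refl with k ℕ.≤? n
      ...   | yes k≤n = ∈-applyUpTo⁺ f (s≤s k≤n)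
      ...   | no k≰n = ⊥-elim (¬e<t (trans (≤-<-trans e≤fn fn<fk) y<t))
        where fn<fk = increasing⇒monotone f inc (≰⇒> k≰n)

module LadderProperties (em : ExcludedMiddle 0ℓ) (T : Tree) (C : Ladder T)
                        (ladder : IsLadderSystem T C) (transitive : IsTransitive T C) where
  open Tree T
  open TreeProperties em T

  C⊆↓ : ∀ {t s} → C t s → s < t
  C⊆↓ {t} = proj₁ (ladder t) _

  ladder-bounded-covered : NoLimitBranching T → ∀ {s t} → ¬ Comparable s t →
                           ∃ λ xs → ∀ {y} → C s y → y < t → y ∈ xs
  ladder-bounded-covered nlb {s} s⊥t with proj₂ (ladder s)
  ... | inj₁ (xs , enum) = xs , λ Csy _ → proj₁ (enum _) Csy
  ... | inj₂ cofinal with incomparable⇒escapes nlb (cofinal⇒limitHeight C⊆↓ cofinal) s⊥t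
  ...   | e , e<s , ¬e<t = cofinal-bounded-covered cofinal e<s ¬e<t

  module _ {A : Subset T} where
    head∈A : ∀ {x z} → PathIn T C A x z → A x
    head∈A (stop Ax) = Ax
    head∈A (step Ax _ _) = Ax

    head∈⇒meets : ∀ {F x z} (p : PathIn T C A x z) → x ∈ F → Meets T F p
    head∈⇒meets (stop _) x∈F = x∈F
    head∈⇒meets (step _ _ _) x∈F = inj₁ x∈F

  module _ (s : Carrier) where
    data Descends : Carrier → Set where
      base : Descends s
      down : ∀ {x y} → C x y → Descends y → Descends x

    descends⇒≥ : ∀ {x} → Descends x → s ≤ x
    descends⇒≥ base = inj₁ refl
    descends⇒≥ (down c d) = inj₂ (≤-<-trans (descends⇒≥ d) (C⊆↓ c))

    descend-step : ∀ {x y} → Descends x → C x y → C s y ⊎ Descends y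
    descend-step base c = inj₁ c
    descend-step {x} {y} (down {y = z} c′ d) c with below-linear x y z (C⊆↓ c) (C⊆↓ c′)
    ... | inj₁ y<z = descend-step d (transitive x z c′ y c y<z)
    ... | inj₂ (inj₁ refl) = inj₂ d
    ... | inj₂ (inj₂ z<y) = inj₂ (down (transitive x y c z c′ z<y) d)

    ladder-separates : ∀ {A t} (F : List Carrier) → (∀ {y} → A y → C s y → y ∈ F) →
                       ¬ s ≤ t → (p : PathIn T C A s t) → Meets T F p
    ladder-separates {A} {t} F C∩A⊆F s≰t = walk base
      where
        walk : ∀ {x} → Descends x → (p : PathIn T C A x t) → Meets T F p
        walk d (stop _) = ⊥-elim (s≰t (descends⇒≥ d))
        walk d (step _ (inj₁ c) p) = inj₂ (walk (down c d) p)
        walk d (step _ (inj₂ c) p) with descend-step d c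
        ... | inj₁ Csy = inj₂ (head∈⇒meets p (C∩A⊆F (head∈A p) Csy))
        ... | inj₂ d′ = inj₂ (walk d′ p)

  incomparable⇒notOmegaConnected :
    NoLimitBranching T → ∀ {A s t} → A s → A t → ¬ Comparable s t →
    (∀ {y} → A y → C s y → y < t) → NotOmegaConnected T C A
  incomparable⇒notOmegaConnected nlb {A} {s} {t} As At s⊥t C∩A⊆t↓
    with ladder-bounded-covered nlb s⊥t
  ... | xs , cover =
    s , t , F , As , At , (λ u u∈F → proj₁ (∈F u u∈F)) ,
    (λ s∈F → <-irrefl (C⊆↓ (proj₂ (∈F s s∈F)))) ,
    (λ t∈F → s⊥t (inj₂ (inj₂ (C⊆↓ (proj₂ (∈F t t∈F)))))) ,
    ladder-separates s F (λ Ay Csy → proj₁ (F-enum _) (Ay , Csy)) (λ s≤t → s⊥t (≤⇒comparable s≤t))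
    where
      finite : FiniteSet T (λ y → A y × C s y)
      finite = covered⇒finite xs λ (Ay , Csy) → cover Csy (C∩A⊆t↓ Ay Csy)
      F = proj₁ finite
      F-enum = proj₂ finite
      ∈F : ∀ u → u ∈ F → A u × C s u
      ∈F u = proj₂ (F-enum u)

lemma2 : ExcludedMiddle 0ℓ → (T : Tree) → (C : Ladder T) →
    IsLadderSystem T C → IsTransitive T C →
    NoLimitBranching T → NoUncountableChains T →
    (A : Subset T) → Uncountable T A → NotOmegaConnected T C A
lemma2 em T C ladder transitive nlb nuc A uncountable = separate incomparable-pair
  where
    open TreeProperties em T
    open LadderProperties em T C ladder transitive

    incomparable-pair : ∃₂ λ x t → A x × A t × ¬ Comparable x t
    incomparable-pair = dne λ ∄ →
      uncountable (nuc A λ x t Ax At → dne λ x⊥t → ∄ (x , t , Ax , At , x⊥t))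

    separate : (∃₂ λ x t → A x × A t × ¬ Comparable x t) → NotOmegaConnected T C A
    separate (x , t , Ax , At , x⊥t)
      with ∃-minimal (λ s → A s × ¬ Comparable s t) (Ax , x⊥t)
    ... | s , (As , s⊥t) , _ , minimal =
      incomparable⇒notOmegaConnected nlb As At s⊥t λ Ay Csy →
        dne λ ¬y<t → minimal (C⊆↓ Csy) (Ay , incomparable-below (C⊆↓ Csy) s⊥t ¬y<t)
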